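{- Let $n,k$ be positive integers and let $q$ be a positive integer with prime factorization $q=p_{1}^{m_{1}}\cdots p_{l}^{m_{l}}$. Suppose $q$ has a small $P$ factor, i.e. there is $j$ with $p_j\in P$ and $p_{j}^{m_{j}}<q^{1/k}$. Then there is $\beta\in(\mathbb{Z}/q\mathbb{Z})^{\times}$ such that $\beta^{n}=1$ and $|n\beta|>q^{1-1/k}-n$.
   Context: $P$ denotes the set of primes $p$ with $\gcd(p-1,n)>1$ and $p\nmid n$. For $a\in\mathbb{Z}/q\mathbb{Z}$, $|a|:=\min\{|a'|:a'\in\mathbb{Z},\ a'\in a+q\mathbb{Z}\}$. -}

module Defs where

open import Data.Nat using (ℕ; suc; _∸_; _^_; _*_; _≤_; _<_; _⊓_; NonZero)
open import Data.Nat.DivMod using (_%_)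
open import Data.Nat.Divisibility using (_∣_)
open import Data.Nat.GCD using (gcd)
open import Data.Nat.Primality using (Prime)
open import Data.Product using (_×_; ∃₂)
open import Relation.Nullary using (¬_)

InP : ℕ → ℕ → Set
InP n p = Prime p × (1 < gcd (p ∸ 1) n) × ¬ (p ∣ n)

-- q has a small P factor (w.r.t. n and k): there is a prime p ∈ P whose
-- exact power p^m (m ≥ 1, p^m ∣ q, p^(m+1) ∤ q) in q satisfies p^m < q^(1/k),
-- i.e. (p^m)^k < q.
SmallPFactor : ℕ → ℕ → ℕ → Set
SmallPFactor n k q = ∃₂ λ p m →
  InP n p × 1 ≤ m × (p ^ m) ∣ q × ¬ ((p ^ suc m) ∣ q) × (p ^ m) ^ k < q

-- |a| for a ∈ ℤ/qℤ represented by a natural number a: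
-- distance of a mod q to 0, i.e. min(a mod q, q - a mod q).
absMod : (q : ℕ) .{{_ : NonZero q}} → ℕ → ℕ
absMod q a = (a % q) ⊓ (q ∸ (a % q))

module Submission where

-- Write q = r·P, where P = pᵐ is the exact power of p dividing q, so that gcd(r, P) = 1.
-- Since d = gcd(p − 1, n) > 1, the monic polynomial Xᵉ − 1, e = (p − 1)/d < p − 1, cannot vanish
-- on all of 1, …, p − 1 modulo p; for a non-root x, y = xᵉ satisfies yᵈ ≡ 1 ≢ y (mod p) by Fermat,
-- and z = y^(pᵐ⁻¹) lifts this to zᵈ ≡ 1 (mod P) with z ≡ y ≢ 1 (mod p).  By the Chinese remainder
-- theorem take β ≡ z (mod P) and β ≡ 1 (mod r).  Then βⁿ ≡ 1 (mod q), and nβ − n is divisible by r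
-- but not by p, hence nonzero modulo q; this forces |nβ| + n ≥ r = q/P, and P < q^(1/k) turns it
-- into |nβ| + n > q^(1−1/k).

module Congruence where

  open import Data.Nat.Base as ℕ using (ℕ; zero; suc)
  import Data.Nat.Properties as ℕ
  open import Data.Nat.Divisibility as ℕ using (divides)
  open import Data.Nat.Coprimality using (Coprime; coprime⇒gcd≡1; coprime-Bézout)
  open import Data.Nat.GCD using (module Bézout)
  open import Data.Nat.LCM using (lcm; lcm-least; gcd*lcm)
  open import Data.Integer.Base
  open import Data.Integer.Properties
  open import Data.Integer.Divisibility.Signed
  open import Data.Integer.DivMod using (a≡a%ℕn+[a/ℕn]*n; n%ℕd<d)
  open import Data.Integer.Tactic.RingSolver using (solve-∀)
  open import Data.Product.Base using (∃; _,_; _×_)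
  open import Function.Base using (_∘_)
  open import Relation.Binary.Bundles using (Setoid)
  open import Relation.Nullary.Decidable using (Dec; map′)
  open import Relation.Nullary.Negation using (¬_)
  open import Relation.Binary.PropositionalEquality

  infix 4 _≡_mod_ _≡?_mod_
  record _≡_mod_ (a b : ℤ) (m : ℕ) : Set where
    constructor mod-∣
    field ∣-difference : + m ∣ a - b
  open _≡_mod_ public

  ≡mod-reflexive : ∀ {m a b} → a ≡ b → a ≡ b mod m
  ≡mod-reflexive {a = a} refl = mod-∣ (divides 0ℤ (+-inverseʳ a))

  ≡mod-refl : ∀ {m a} → a ≡ a mod m
  ≡mod-refl = ≡mod-reflexive refl

  ≡mod-sym : ∀ {m a b} → a ≡ b mod m → b ≡ a mod m
  ≡mod-sym {m} {a} {b} (mod-∣ m∣a-b) = mod-∣ (subst (+ m ∣_) (negate a b) (∣m⇒∣-m m∣a-b))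
    where
    negate : ∀ a b → - (a - b) ≡ b - a
    negate = solve-∀

  ≡mod-trans : ∀ {m a b c} → a ≡ b mod m → b ≡ c mod m → a ≡ c mod m
  ≡mod-trans {m} {a} {b} {c} (mod-∣ m∣a-b) (mod-∣ m∣b-c) =
    mod-∣ (subst (+ m ∣_) (telescope a b c) (∣m∣n⇒∣m+n m∣a-b m∣b-c))
    where
    telescope : ∀ a b c → (a - b) + (b - c) ≡ a - c
    telescope = solve-∀

  ≡mod-setoid : ℕ → Setoid _ _
  ≡mod-setoid m = record
    { Carrier       = ℤ
    ; _≈_           = λ a b → a ≡ b mod m
    ; isEquivalence = record { refl = ≡mod-refl ; sym = ≡mod-sym ; trans = ≡mod-trans }
    }

  _≡?_mod_ : ∀ a b m → Dec (a ≡ b mod m)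
  a ≡? b mod m = map′ mod-∣ ∣-difference (+ m ∣? (a - b))

  +-cong-mod : ∀ {m a b c d} → a ≡ b mod m → c ≡ d mod m → a + c ≡ b + d mod m
  +-cong-mod {m} {a} {b} {c} {d} (mod-∣ m∣a-b) (mod-∣ m∣c-d) =
    mod-∣ (subst (+ m ∣_) (regroup a b c d) (∣m∣n⇒∣m+n m∣a-b m∣c-d))
    where
    regroup : ∀ a b c d → (a - b) + (c - d) ≡ (a + c) - (b + d)
    regroup = solve-∀

  *-cong-mod : ∀ {m a b c d} → a ≡ b mod m → c ≡ d mod m → a * c ≡ b * d mod m
  *-cong-mod {m} {a} {b} {c} {d} (mod-∣ m∣a-b) (mod-∣ m∣c-d) =
    mod-∣ (subst (+ m ∣_) (regroup a b c d) (∣m∣n⇒∣m+n (∣m⇒∣m*n c m∣a-b) (∣n⇒∣m*n b m∣c-d)))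
    where
    regroup : ∀ a b c d → (a - b) * c + b * (c - d) ≡ a * c - b * d
    regroup = solve-∀

  ^-cong-mod : ∀ {m a b} n → a ≡ b mod m → a ^ n ≡ b ^ n mod m
  ^-cong-mod zero    _   = ≡mod-refl
  ^-cong-mod (suc n) a≡b = *-cong-mod a≡b (^-cong-mod n a≡b)

  ≡1-mod⇒^≡1-mod : ∀ {m w} n → w ≡ 1ℤ mod m → w ^ n ≡ 1ℤ mod m
  ≡1-mod⇒^≡1-mod {m} {w} n w≡1 = subst (λ v → w ^ n ≡ v mod m) (^-zeroˡ n) (^-cong-mod n w≡1)

  ^≡1-mod-∣ : ∀ {m w d n} → w ^ d ≡ 1ℤ mod m → d ℕ.∣ n → w ^ n ≡ 1ℤ mod m
  ^≡1-mod-∣ {m} {w} {d} {n} wᵈ≡1 (divides f n≡fd) =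
    subst (λ k → w ^ k ≡ 1ℤ mod m) (trans (ℕ.*-comm d f) (sym n≡fd))
      (subst (λ v → v ≡ 1ℤ mod m) (^-*-assoc w d f) (≡1-mod⇒^≡1-mod {m} {w ^ d} f wᵈ≡1))

  ∣⇒≡0-mod : ∀ {m a} → + m ∣ a → a ≡ 0ℤ mod m
  ∣⇒≡0-mod {m} {a} m∣a = mod-∣ (subst (+ m ∣_) (sym (+-identityʳ a)) m∣a)

  ≡0-mod⇒∣ : ∀ {m a} → a ≡ 0ℤ mod m → + m ∣ a
  ≡0-mod⇒∣ {m} {a} (mod-∣ m∣a-0) = subst (+ m ∣_) (+-identityʳ a) m∣a-0

  ≡mod-+-multiple : ∀ {m} a k → a + k * + m ≡ a mod m
  ≡mod-+-multiple {m} a k = mod-∣ (divides k (cancel a k (+ m)))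
    where
    cancel : ∀ a k m → a + k * m - a ≡ k * m
    cancel = solve-∀

  ≡mod-divisor : ∀ {d m a b} → d ℕ.∣ m → a ≡ b mod m → a ≡ b mod d
  ≡mod-divisor d∣m (mod-∣ m∣a-b) = mod-∣ (∣-trans (∣ᵤ⇒∣ d∣m) m∣a-b)

  ≡mod-coprime-* : ∀ {m n a b} → Coprime m n → a ≡ b mod m → a ≡ b mod n → a ≡ b mod m ℕ.* n
  ≡mod-coprime-* {m} {n} m⊥n (mod-∣ m∣a-b) (mod-∣ n∣a-b) =
    mod-∣ (∣ᵤ⇒∣ (subst (ℕ._∣ _) lcm≡m*n (lcm-least (∣⇒∣ᵤ m∣a-b) (∣⇒∣ᵤ n∣a-b))))
    where
    lcm≡m*n : lcm m n ≡ m ℕ.* n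
    lcm≡m*n = trans (sym (ℕ.*-identityˡ (lcm m n)))
                (trans (cong (ℕ._* lcm m n) (sym (coprime⇒gcd≡1 m⊥n))) (gcd*lcm m n))

  %ℕ-≡mod : ∀ m .{{_ : ℕ.NonZero m}} x → + (x %ℕ m) ≡ x mod m
  %ℕ-≡mod m x = mod-∣ (divides (- (x /ℕ m)) (begin
    + (x %ℕ m) - x                              ≡⟨ cong (λ y → + (x %ℕ m) - y) (a≡a%ℕn+[a/ℕn]*n x m) ⟩
    + (x %ℕ m) - (+ (x %ℕ m) + (x /ℕ m) * + m)  ≡⟨ cancel (+ (x %ℕ m)) (x /ℕ m) (+ m) ⟩
    - (x /ℕ m) * + m                            ∎))
    where
    open ≡-Reasoning
    cancel : ∀ r k m → r - (r + k * m) ≡ - k * m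
    cancel = solve-∀

  ∣⇒≤∣∣ : ∀ {m i} → + m ∣ i → i ≢ 0ℤ → m ℕ.≤ ∣ i ∣
  ∣⇒≤∣∣ m∣i i≢0 = ℕ.∣⇒≤ {{ℕ.≢-nonZero (i≢0 ∘ ∣i∣≡0⇒i≡0)}} (∣⇒∣ᵤ m∣i)

  ∤-small : ∀ {m i} → 0 ℕ.< ∣ i ∣ → ∣ i ∣ ℕ.< m → ¬ (+ m ∣ i)
  ∤-small 0<∣i∣ ∣i∣<m m∣i =
    ℕ.<⇒≱ ∣i∣<m (∣⇒≤∣∣ m∣i λ { refl → ℕ.<-irrefl refl 0<∣i∣ })

  ∃-inverse : ∀ {m n} → Coprime m n → ∃ λ t → + n * t ≡ 1ℤ mod m
  ∃-inverse {m} {n} m⊥n with coprime-Bézout m⊥n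
  ... | Bézout.+- x y 1+yn≡xm = - + y , ≡mod-trans (≡mod-reflexive (begin
    + n * - + y             ≡⟨ negate (+ n) (+ y) ⟩
    1ℤ - (1ℤ + + y * + n)   ≡⟨ cong (λ v → 1ℤ - (1ℤ + v)) (sym (pos-* y n)) ⟩
    1ℤ - + (1 ℕ.+ y ℕ.* n)  ≡⟨ cong (λ v → 1ℤ - + v) 1+yn≡xm ⟩
    1ℤ - + (x ℕ.* m)        ≡⟨ cong (λ v → 1ℤ - v) (pos-* x m) ⟩
    1ℤ - + x * + m          ≡⟨ cong (_+_ 1ℤ) (neg-distribˡ-* (+ x) (+ m)) ⟩
    1ℤ + - + x * + m        ∎)) (≡mod-+-multiple 1ℤ (- + x))
    where
    open ≡-Reasoning
    negate : ∀ n y → n * - y ≡ 1ℤ - (1ℤ + y * n)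
    negate = solve-∀
  ... | Bézout.-+ x y 1+xm≡yn = + y , ≡mod-trans (≡mod-reflexive (begin
    + n * + y               ≡⟨ sym (pos-* n y) ⟩
    + (n ℕ.* y)             ≡⟨ cong +_ (ℕ.*-comm n y) ⟩
    + (y ℕ.* n)             ≡⟨ cong +_ (sym 1+xm≡yn) ⟩
    + (1 ℕ.+ x ℕ.* m)       ≡⟨ cong (_+_ 1ℤ) (pos-* x m) ⟩
    1ℤ + + x * + m          ∎)) (≡mod-+-multiple 1ℤ (+ x))
    where open ≡-Reasoning

  chineseRemainder : ∀ {m n} → Coprime m n → ∀ u v → ∃ λ x → x ≡ u mod m × x ≡ v mod n
  chineseRemainder {m} {n} m⊥n u v with ∃-inverse m⊥n
  ... | t , nt≡1 = v + (+ n * t) * (u - v) , ≡u , ≡v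
    where
    ≡u : v + (+ n * t) * (u - v) ≡ u mod m
    ≡u = ≡mod-trans {b = v + 1ℤ * (u - v)}
           (+-cong-mod (≡mod-refl {a = v}) (*-cong-mod nt≡1 (≡mod-refl {a = u - v})))
           (≡mod-reflexive (cancel u v))
      where
      cancel : ∀ u v → v + 1ℤ * (u - v) ≡ u
      cancel = solve-∀
    ≡v : v + (+ n * t) * (u - v) ≡ v mod n
    ≡v = ≡mod-trans {b = v + (t * (u - v)) * + n}
           (≡mod-reflexive (regroup v (+ n) t u)) (≡mod-+-multiple v (t * (u - v)))
      where
      regroup : ∀ v n t u → v + (n * t) * (u - v) ≡ v + (t * (u - v)) * n
      regroup = solve-∀

  ∃-representative : ∀ {m n q} .{{_ : ℕ.NonZero q}} → m ℕ.∣ q → n ℕ.∣ q → Coprime m n →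
    ∀ u v → ∃ λ b → b ℕ.< q × + b ≡ u mod m × + b ≡ v mod n
  ∃-representative {m} {n} {q} m∣q n∣q m⊥n u v = reduce (chineseRemainder m⊥n u v)
    where
    reduce : (∃ λ x → x ≡ u mod m × x ≡ v mod n) → ∃ λ b → b ℕ.< q × + b ≡ u mod m × + b ≡ v mod n
    reduce (x , x≡u , x≡v) = x %ℕ q , n%ℕd<d x q ,
      ≡mod-trans {b = x} (≡mod-divisor m∣q (%ℕ-≡mod q x)) x≡u ,
      ≡mod-trans {b = x} (≡mod-divisor n∣q (%ℕ-≡mod q x)) x≡v

module PrimeModulus where

  open import Data.Nat.Base as ℕ using (ℕ; zero; suc; _∸_; _<_; _!; s≤s; z≤n; nonTrivial⇒≢1)
  import Data.Nat.Properties as ℕ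
  open import Data.Nat.Divisibility as ℕ using (_∤_)
  open import Data.Nat.DivMod using (m/n*n≡m)
  open import Data.Nat.Primality using (Prime; euclidsLemma; prime⇒nonZero; prime⇒nonTrivial)
  open import Data.Nat.Combinatorics using (_C_; nCk≡n!/k![n-k]!; k![n∸k]!∣n!; nCn≡1)
  open import Data.Fin.Base as Fin using (toℕ)
  import Data.Fin.Properties as Fin
  open import Data.Vec.Functional using (Vector; tail; init; last)
  open import Data.Integer.Base using (ℤ; +_; _+_; _-_; _*_; _^_; _%ℕ_; ∣_∣; 0ℤ; 1ℤ)
  open import Data.Integer.Properties
    using (+-*-commutativeSemiring; +-identityˡ; *-identityˡ; *-identityʳ; +-comm; ^-zeroˡ; ^-*-assoc;
           suc-*; abs-*)
  open import Data.Integer.Divisibility.Signed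
    using (_∣_; divides; ∣ᵤ⇒∣; ∣⇒∣ᵤ; ∣m⇒∣m*n; ∣m∣n⇒∣m+n)
  open import Data.Integer.Tactic.RingSolver using (solve-∀)
  open import Algebra.Bundles using (CommutativeSemiring)
  import Algebra.Definitions.RawSemiring as RawSemiringDefinitions
  import Algebra.Properties.CommutativeSemiring.Binomial as BinomialTheorem
  import Algebra.Properties.Monoid.Sum as MonoidSum
  open import Data.Sum.Base using (_⊎_; inj₁; inj₂)
  open import Function.Base using (_∘_)
  open import Relation.Nullary.Negation using (¬_; contradiction)
  open import Relation.Binary.PropositionalEquality
  import Relation.Binary.Reasoning.Setoid as ≈-Reasoning
  open Congruence

  prime∤! : ∀ {p} → Prime p → ∀ j → j < p → p ∤ j !
  prime∤! p-prime zero    _   p∣1 =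
    contradiction (ℕ.∣1⇒≡1 p∣1) (nonTrivial⇒≢1 {{prime⇒nonTrivial p-prime}})
  prime∤! p-prime (suc j) j<p p∣j! with euclidsLemma (suc j) (j !) p-prime p∣j!
  ... | inj₁ p∣1+j = ℕ.<⇒≱ j<p (ℕ.∣⇒≤ p∣1+j)
  ... | inj₂ p∣j!  = prime∤! p-prime j (ℕ.<-trans (ℕ.n<1+n j) j<p) p∣j!

  prime∣binomial : ∀ {p k} → Prime p → 0 < k → k < p → p ℕ.∣ p C k
  prime∣binomial {p@(suc p-1)} {k} p-prime 0<k k<p
    with euclidsLemma (p C k) (k ! ℕ.* (p ∸ k) !) p-prime p∣C·k!·[p-k]!
    where
    k≤p = ℕ.<⇒≤ k<p
    instance _ = ℕ._!*_!≢0 k (p ∸ k)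
    C·k!·[p-k]!≡p! : (p C k) ℕ.* (k ! ℕ.* (p ∸ k) !) ≡ p !
    C·k!·[p-k]!≡p! = trans (cong (ℕ._* (k ! ℕ.* (p ∸ k) !)) (nCk≡n!/k![n-k]! k≤p))
                           (m/n*n≡m (k![n∸k]!∣n! k≤p))
    p∣C·k!·[p-k]! : p ℕ.∣ (p C k) ℕ.* (k ! ℕ.* (p ∸ k) !)
    p∣C·k!·[p-k]! = subst (p ℕ.∣_) (sym C·k!·[p-k]!≡p!) (ℕ.m∣m*n (p-1 !))
  ... | inj₁ p∣C = p∣C
  ... | inj₂ p∣k!·[p-k]! with euclidsLemma (k !) ((p ∸ k) !) p-prime p∣k!·[p-k]!
  ...   | inj₁ p∣k!     = contradiction p∣k! (prime∤! p-prime k k<p)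
  ...   | inj₂ p∣[p-k]! = contradiction p∣[p-k]! (prime∤! p-prime (p ∸ k) (ℕ.∸-monoʳ-< 0<k (ℕ.<⇒≤ k<p)))

  open CommutativeSemiring +-*-commutativeSemiring using (rawSemiring; +-monoid)
  open RawSemiringDefinitions rawSemiring using () renaming (_^_ to _^ˢ_; _×_ to _×ˢ_; sum to ∑)
  open BinomialTheorem +-*-commutativeSemiring using (binomialTerm) renaming (theorem to binomialTheorem)
  open MonoidSum +-monoid using (sum-init-last)

  ^ˢ≡^ : ∀ x n → x ^ˢ n ≡ x ^ n
  ^ˢ≡^ x zero    = refl
  ^ˢ≡^ x (suc n) = cong (x *_) (^ˢ≡^ x n)

  ×ˢ≡* : ∀ n x → n ×ˢ x ≡ + n * x
  ×ˢ≡* zero    x = refl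
  ×ˢ≡* (suc n) x = trans (cong (_+_ x) (×ˢ≡* n x)) (sym (suc-* (+ n) x))

  ∑-∣ : ∀ {m n} (v : Vector ℤ n) → (∀ i → m ∣ v i) → m ∣ ∑ v
  ∑-∣ {n = zero}  v m∣v = divides 0ℤ refl
  ∑-∣ {n = suc n} v m∣v = ∣m∣n⇒∣m+n (m∣v Fin.zero) (∑-∣ (tail v) (m∣v ∘ Fin.suc))

  binomialTerm-1 : ∀ x p k → binomialTerm x 1ℤ p k ≡ + (p C toℕ k) * x ^ toℕ k
  binomialTerm-1 x p k = begin
    (p C j) ×ˢ (x ^ˢ j * 1ℤ ^ˢ (p ∸ j))   ≡⟨ ×ˢ≡* (p C j) _ ⟩
    + (p C j) * (x ^ˢ j * 1ℤ ^ˢ (p ∸ j))  ≡⟨ cong (λ y → + (p C j) * y) (cong₂ _*_ (^ˢ≡^ x j) 1ˢ≡1) ⟩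
    + (p C j) * (x ^ j * 1ℤ)              ≡⟨ cong (λ y → + (p C j) * y) (*-identityʳ (x ^ j)) ⟩
    + (p C j) * x ^ j                     ∎
    where
    open ≡-Reasoning
    j = toℕ k
    1ˢ≡1 : 1ℤ ^ˢ (p ∸ j) ≡ 1ℤ
    1ˢ≡1 = trans (^ˢ≡^ 1ℤ (p ∸ j)) (^-zeroˡ (p ∸ j))

  freshman's-dream : ∀ {p} → Prime p → ∀ x → (x + 1ℤ) ^ p ≡ x ^ p + 1ℤ mod p
  freshman's-dream {p@(suc (suc t))} p-prime x = begin
    (x + 1ℤ) ^ p                                   ≡⟨ sym (^ˢ≡^ (x + 1ℤ) p) ⟩
    (x + 1ℤ) ^ˢ p                                  ≡⟨ binomialTheorem p x 1ℤ ⟩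
    term Fin.zero + ∑ (tail term)                  ≡⟨ cong (_+_ (term Fin.zero)) (sum-init-last (tail term)) ⟩
    term Fin.zero + (∑ middle + last (tail term))  ≈⟨ +-cong-mod (≡mod-reflexive first≡1)
                                                        (+-cong-mod middle≡0 (≡mod-reflexive last≡xᵖ)) ⟩
    1ℤ + (0ℤ + x ^ p)                              ≡⟨ cong (_+_ 1ℤ) (+-identityˡ (x ^ p)) ⟩
    1ℤ + x ^ p                                     ≡⟨ +-comm 1ℤ (x ^ p) ⟩
    x ^ p + 1ℤ                                     ∎
    where
    open ≈-Reasoning (≡mod-setoid p)
    term : Vector ℤ (suc p)
    term = binomialTerm x 1ℤ p
    middle : Vector ℤ (suc t)
    middle = init (tail term)
    term≡ : ∀ k {j} → toℕ k ≡ j → term k ≡ + (p C j) * x ^ j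
    term≡ k refl = binomialTerm-1 x p k
    first≡1 : term Fin.zero ≡ 1ℤ
    first≡1 = term≡ Fin.zero refl
    last≡xᵖ : last (tail term) ≡ x ^ p
    last≡xᵖ = trans (term≡ _ (cong suc (Fin.toℕ-fromℕ (suc t))))
                (trans (cong (λ c → + c * x ^ p) (nCn≡1 p)) (*-identityˡ (x ^ p)))
    p∣middle : ∀ i → + p ∣ middle i
    p∣middle i = subst (+ p ∣_) (sym (term≡ _ (cong suc (Fin.toℕ-inject₁ i))))
      (∣m⇒∣m*n (x ^ suc (toℕ i))
        (∣ᵤ⇒∣ {+ p} {+ (p C suc (toℕ i))} (prime∣binomial p-prime (s≤s z≤n) (s≤s (Fin.toℕ<n i)))))
    middle≡0 : ∑ middle ≡ 0ℤ mod p
    middle≡0 = ∣⇒≡0-mod (∑-∣ middle p∣middle)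

  fermat : ∀ {p} → Prime p → ∀ x → x ^ p ≡ x mod p
  fermat {p} p-prime x = begin
    x ^ p      ≈⟨ ^-cong-mod p (≡mod-sym (%ℕ-≡mod p x)) ⟩
    (+ r) ^ p  ≈⟨ fermat-pos r ⟩
    + r        ≈⟨ %ℕ-≡mod p x ⟩
    x          ∎
    where
    open ≈-Reasoning (≡mod-setoid p)
    instance _ = prime⇒nonZero p-prime
    r = x %ℕ p
    fermat-pos : ∀ a → (+ a) ^ p ≡ + a mod p
    fermat-pos zero    = ≡mod-reflexive (^-zeroˡ′ p)
      where
      ^-zeroˡ′ : ∀ n .{{_ : ℕ.NonZero n}} → 0ℤ ^ n ≡ 0ℤ
      ^-zeroˡ′ (suc n) = refl
    fermat-pos (suc a) = begin
      (+ suc a) ^ p    ≡⟨ cong (_^ p) +suc≡+1 ⟩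
      (+ a + 1ℤ) ^ p   ≈⟨ freshman's-dream p-prime (+ a) ⟩
      (+ a) ^ p + 1ℤ   ≈⟨ +-cong-mod (fermat-pos a) (≡mod-refl {a = 1ℤ}) ⟩
      + a + 1ℤ         ≡⟨ sym +suc≡+1 ⟩
      + suc a          ∎
      where
      +suc≡+1 : + suc a ≡ + a + 1ℤ
      +suc≡+1 = cong +_ (ℕ.+-comm 1 a)

  fermat-^ : ∀ {p} → Prime p → ∀ x i → x ^ (p ℕ.^ i) ≡ x mod p
  fermat-^ {p} p-prime x zero    = ≡mod-reflexive (*-identityʳ x)
  fermat-^ {p} p-prime x (suc i) = begin
    x ^ (p ℕ.* p ℕ.^ i)  ≡⟨ sym (^-*-assoc x p (p ℕ.^ i)) ⟩
    (x ^ p) ^ (p ℕ.^ i)  ≈⟨ ^-cong-mod (p ℕ.^ i) (fermat p-prime x) ⟩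
    x ^ (p ℕ.^ i)        ≈⟨ fermat-^ p-prime x i ⟩
    x                    ∎
    where open ≈-Reasoning (≡mod-setoid p)

  euclidsLemmaℤ : ∀ {p} → Prime p → ∀ x y → + p ∣ x * y → (+ p ∣ x) ⊎ (+ p ∣ y)
  euclidsLemmaℤ p-prime x y p∣xy
    with euclidsLemma ∣ x ∣ ∣ y ∣ p-prime (subst (_ ℕ.∣_) (abs-* x y) (∣⇒∣ᵤ p∣xy))
  ... | inj₁ p∣x = inj₁ (∣ᵤ⇒∣ p∣x)
  ... | inj₂ p∣y = inj₂ (∣ᵤ⇒∣ p∣y)

  *-cancelˡ-mod : ∀ {p} → Prime p → ∀ {x y z} → ¬ (+ p ∣ x) → x * y ≡ x * z mod p → y ≡ z mod p
  *-cancelˡ-mod {p} p-prime {x} {y} {z} p∤x (mod-∣ p∣xy-xz)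
    with euclidsLemmaℤ p-prime x (y - z) (subst (+ p ∣_) (factor x y z) p∣xy-xz)
    where
    factor : ∀ x y z → x * y - x * z ≡ x * (y - z)
    factor = solve-∀
  ... | inj₁ p∣x   = contradiction p∣x p∤x
  ... | inj₂ p∣y-z = mod-∣ p∣y-z

  fermat-∤ : ∀ {p} → Prime p → ∀ {x} → ¬ (+ p ∣ x) → x ^ (p ∸ 1) ≡ 1ℤ mod p
  fermat-∤ {p@(suc p-1)} p-prime {x} p∤x = *-cancelˡ-mod p-prime p∤x (begin
    x * x ^ p-1  ≈⟨ fermat p-prime x ⟩
    x            ≡⟨ sym (*-identityʳ x) ⟩
    x * 1ℤ       ∎)
    where open ≈-Reasoning (≡mod-setoid p)

module MonicPolynomial where

  open import Data.Nat.Base as ℕ using (ℕ; zero; suc; _∸_; _<_; _≤_; s≤s; z≤n; nonTrivial⇒n>1)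
  import Data.Nat.Properties as ℕ
  open import Data.Nat.Primality using (Prime; prime⇒nonTrivial)
  open import Data.Integer.Base using (ℤ; +_; _+_; _-_; _*_; ∣_∣; 1ℤ)
  open import Data.Integer.Properties using ([+m]-[+n]≡m⊖n; ∣⊖∣-<)
  open import Data.Integer.Divisibility.Signed using (_∣_; ∣m+n∣n⇒∣m)
  open import Data.Integer.Tactic.RingSolver using (solve-∀)
  open import Data.List.Base using (List; []; _∷_; length)
  open import Data.Sum.Base using (inj₁; inj₂)
  open import Relation.Nullary.Negation using (contradiction)
  open import Relation.Binary.PropositionalEquality
  open Congruence
  open PrimeModulus

  -- cs = c₀ ∷ … ∷ cₑ₋₁ stands for c₀ + c₁ X + ⋯ + cₑ₋₁ Xᵉ⁻¹ + Xᵉ.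
  evalMonic : List ℤ → ℤ → ℤ
  evalMonic []       x = 1ℤ
  evalMonic (c ∷ cs) x = c + x * evalMonic cs x

  -- quotient a cs is the quotient of c ∷ cs by X − a, whatever the constant term c.
  quotient : ℤ → List ℤ → List ℤ
  quotient a []       = []
  quotient a (c ∷ cs) = evalMonic (c ∷ cs) a ∷ quotient a cs

  length-quotient : ∀ a cs → length (quotient a cs) ≡ length cs
  length-quotient a []       = refl
  length-quotient a (c ∷ cs) = cong suc (length-quotient a cs)

  evalMonic-factor : ∀ a c cs x →
    evalMonic (c ∷ cs) x ≡ (x - a) * evalMonic (quotient a cs) x + evalMonic (c ∷ cs) a
  evalMonic-factor a c []        x = regroup a c x
    where
    regroup : ∀ a c x → c + x * 1ℤ ≡ (x - a) * 1ℤ + (c + a * 1ℤ)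
    regroup = solve-∀
  evalMonic-factor a c (c′ ∷ cs) x = begin
    c + x * evalMonic (c′ ∷ cs) x                  ≡⟨ cong (λ y → c + x * y) (evalMonic-factor a c′ cs x) ⟩
    c + x * ((x - a) * g + evalMonic (c′ ∷ cs) a)  ≡⟨ regroup a c x g (evalMonic (c′ ∷ cs) a) ⟩
    (x - a) * evalMonic (quotient a (c′ ∷ cs)) x + evalMonic (c ∷ c′ ∷ cs) a ∎
    where
    open ≡-Reasoning
    g = evalMonic (quotient a cs) x
    regroup : ∀ a c x g h → c + x * ((x - a) * g + h) ≡ (x - a) * (h + x * g) + (c + a * h)
    regroup = solve-∀

  -- The roots are taken among 1, …, N, which are pairwise incongruent and nonzero modulo p.
  roots-bound : ∀ {p} → Prime p → ∀ N → N < p → ∀ cs →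
    (∀ x → x < N → + p ∣ evalMonic cs (+ suc x)) → N ≤ length cs
  roots-bound p-prime zero    _   _  _ = z≤n
  roots-bound p-prime (suc N) N<p [] roots =
    contradiction (roots 0 (s≤s z≤n)) (∤-small (s≤s z≤n) (nonTrivial⇒n>1 _ {{prime⇒nonTrivial p-prime}}))
  roots-bound {p} p-prime (suc N) N<p (c ∷ cs) roots =
    s≤s (subst (N ≤_) (length-quotient a cs)
      (roots-bound p-prime N (ℕ.<-trans (ℕ.n<1+n N) N<p) (quotient a cs) quotient-roots))
    where
    a = + suc N
    quotient-roots : ∀ x → x < N → + p ∣ evalMonic (quotient a cs) (+ suc x)
    quotient-roots x x<N
      with euclidsLemmaℤ p-prime (+ suc x - a) (evalMonic (quotient a cs) (+ suc x)) p∣product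
      where
      p∣product : + p ∣ (+ suc x - a) * evalMonic (quotient a cs) (+ suc x)
      p∣product = ∣m+n∣n⇒∣m (subst (+ p ∣_) (evalMonic-factor a c cs (+ suc x)) (roots x (ℕ.m<n⇒m<1+n x<N)))
                            (roots N ℕ.≤-refl)
    ... | inj₂ p∣value = p∣value
    ... | inj₁ p∣x-a   = contradiction p∣x-a (∤-small
      (subst (0 <_) (sym distance) (ℕ.m<n⇒0<n∸m x<N))
      (subst (_< p) (sym distance) (ℕ.≤-<-trans (ℕ.m∸n≤m N x) (ℕ.<-trans (ℕ.n<1+n N) N<p))))
      where
      distance : ∣ + suc x - a ∣ ≡ N ∸ x
      distance = trans (cong ∣_∣ ([+m]-[+n]≡m⊖n (suc x) (suc N))) (∣⊖∣-< (s≤s x<N))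

module RootsOfUnity where

  open import Data.Nat.Base as ℕ using (ℕ; zero; suc; _∸_; _<_; _≤_; s≤s; z≤n; nonTrivial⇒n>1)
  import Data.Nat.Properties as ℕ
  open import Data.Nat.Divisibility as ℕ using (divides)
  open import Data.Nat.Primality using (Prime; prime⇒nonTrivial)
  open import Data.Integer.Base using (ℤ; +_; _+_; _-_; _*_; _^_; 0ℤ; 1ℤ; -1ℤ)
  open import Data.Integer.Properties
    using (*-identityˡ; *-identityʳ; *-zeroʳ; +-identityˡ; +-comm; ^-*-assoc; pos-*)
  open import Data.Integer.Divisibility.Signed using (_∣_; divides; ∣-refl)
  open import Data.Integer.Tactic.RingSolver using (solve-∀)
  open import Data.List.Base using (_∷_; replicate)
  open import Data.List.Properties using (length-replicate)
  open import Data.Product.Base using (∃; _,_; _×_)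
  open import Relation.Nullary.Decidable using (yes; no; ¬?; decidable-stable)
  open import Relation.Nullary.Negation using (¬_; contradiction)
  open import Relation.Binary.PropositionalEquality
  open Congruence
  open PrimeModulus
  open MonicPolynomial

  geometricSum : ℤ → ℕ → ℤ
  geometricSum w zero    = 0ℤ
  geometricSum w (suc k) = 1ℤ + w * geometricSum w k

  ^-1≡*geometricSum : ∀ w k → w ^ k - 1ℤ ≡ (w - 1ℤ) * geometricSum w k
  ^-1≡*geometricSum w zero    = sym (*-zeroʳ (w - 1ℤ))
  ^-1≡*geometricSum w (suc k) = begin
    w * w ^ k - 1ℤ                 ≡⟨ split w (w ^ k) ⟩
    (w - 1ℤ) + w * (w ^ k - 1ℤ)    ≡⟨ cong (λ y → (w - 1ℤ) + w * y) (^-1≡*geometricSum w k) ⟩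
    (w - 1ℤ) + w * ((w - 1ℤ) * G)  ≡⟨ factor w G ⟩
    (w - 1ℤ) * (1ℤ + w * G)        ∎
    where
    open ≡-Reasoning
    G = geometricSum w k
    split : ∀ w v → w * v - 1ℤ ≡ (w - 1ℤ) + w * (v - 1ℤ)
    split = solve-∀
    factor : ∀ w G → (w - 1ℤ) + w * ((w - 1ℤ) * G) ≡ (w - 1ℤ) * (1ℤ + w * G)
    factor = solve-∀

  geometricSum-≡mod : ∀ {m w} k → w ≡ 1ℤ mod m → geometricSum w k ≡ + k mod m
  geometricSum-≡mod zero    _   = ≡mod-refl
  geometricSum-≡mod (suc k) w≡1 =
    ≡mod-trans (+-cong-mod (≡mod-refl {a = 1ℤ}) (*-cong-mod w≡1 (geometricSum-≡mod k w≡1)))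
               (≡mod-reflexive (cong (_+_ 1ℤ) (*-identityˡ (+ k))))

  -- wᵖ − 1 = (w − 1)(1 + w + ⋯ + wᵖ⁻¹), and the second factor is ≡ p ≡ 0 modulo p.
  ^-lift : ∀ {p m w} → p ℕ.∣ m → w ≡ 1ℤ mod m → w ^ p ≡ 1ℤ mod p ℕ.* m
  ^-lift {p} {m} {w} p∣m w≡1@(mod-∣ (divides a w-1≡am)) = mod-∣ (divides (a * b) (begin
    w ^ p - 1ℤ                   ≡⟨ ^-1≡*geometricSum w p ⟩
    (w - 1ℤ) * geometricSum w p  ≡⟨ cong₂ _*_ w-1≡am G≡bp ⟩
    (a * + m) * (b * + p)        ≡⟨ regroup a b (+ m) (+ p) ⟩
    (a * b) * (+ p * + m)        ≡⟨ cong (a * b *_) (sym (pos-* p m)) ⟩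
    (a * b) * + (p ℕ.* m)        ∎))
    where
    open ≡-Reasoning
    p∣G : + p ∣ geometricSum w p
    p∣G = ≡0-mod⇒∣ (≡mod-trans (geometricSum-≡mod p (≡mod-divisor p∣m w≡1)) (∣⇒≡0-mod ∣-refl))
    b = _∣_.quotient p∣G
    G≡bp : geometricSum w p ≡ b * + p
    G≡bp = _∣_.equality p∣G
    regroup : ∀ a b m p → (a * m) * (b * p) ≡ (a * b) * (p * m)
    regroup = solve-∀

  ^-lift-prime-power : ∀ {p w} → w ≡ 1ℤ mod p → ∀ i → w ^ (p ℕ.^ i) ≡ 1ℤ mod p ℕ.^ suc i
  ^-lift-prime-power {p} {w} w≡1 zero =
    subst₂ (λ v m → v ≡ 1ℤ mod m) (sym (*-identityʳ w)) (sym (ℕ.*-identityʳ p)) w≡1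
  ^-lift-prime-power {p} {w} w≡1 (suc i) =
    subst (λ v → v ≡ 1ℤ mod p ℕ.^ suc (suc i)) power-swap
      (^-lift {p} (ℕ.m∣m*n (p ℕ.^ i)) (^-lift-prime-power w≡1 i))
    where
    power-swap : (w ^ (p ℕ.^ i)) ^ p ≡ w ^ (p ℕ.^ suc i)
    power-swap = trans (^-*-assoc w (p ℕ.^ i) p) (cong (w ^_) (ℕ.*-comm (p ℕ.^ i) p))

  evalMonic-replicate-0 : ∀ k x → evalMonic (replicate k 0ℤ) x ≡ x ^ k
  evalMonic-replicate-0 zero    x = refl
  evalMonic-replicate-0 (suc k) x = trans (+-identityˡ _) (cong (x *_) (evalMonic-replicate-0 k x))

  ∃-root-of-unity≢1 : ∀ {p d} → Prime p → 1 < d → d ℕ.∣ p ∸ 1 →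
    ∃ λ y → y ^ d ≡ 1ℤ mod p × ¬ (y ≡ 1ℤ mod p)
  ∃-root-of-unity≢1 {p} p-prime _ (divides zero p-1≡0) =
    contradiction p-1≡0 (ℕ.m<n⇒n≢0 (ℕ.m<n⇒0<n∸m (nonTrivial⇒n>1 p {{prime⇒nonTrivial p-prime}})))
  ∃-root-of-unity≢1 {p@(suc p-1)} {d} p-prime 1<d (divides e@(suc e-1) p-1≡ed)
    with ℕ.anyUpTo? (λ x → ¬? ((+ suc x) ^ e ≡? 1ℤ mod p)) p-1
  ... | yes (x , x<p-1 , xᵉ≢1) = (+ suc x) ^ e , yᵈ≡1 , xᵉ≢1
    where
    yᵈ≡1 : ((+ suc x) ^ e) ^ d ≡ 1ℤ mod p
    yᵈ≡1 = subst (λ v → v ≡ 1ℤ mod p)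
      (trans (cong ((+ suc x) ^_) p-1≡ed) (sym (^-*-assoc (+ suc x) e d)))
      (fermat-∤ p-prime (∤-small (s≤s z≤n) (s≤s x<p-1)))
  ... | no ∄x = contradiction p-1≤e (ℕ.<⇒≱ e<p-1)
    where
    e<p-1 : e < p-1
    e<p-1 = subst₂ _<_ (ℕ.*-identityʳ e) (sym p-1≡ed) (ℕ.*-monoʳ-< e 1<d)
    Xᵉ-1 = -1ℤ ∷ replicate e-1 0ℤ
    evalMonic-Xᵉ-1 : ∀ y → y ^ e - 1ℤ ≡ evalMonic Xᵉ-1 y
    evalMonic-Xᵉ-1 y = trans (+-comm (y ^ e) -1ℤ)
      (cong (λ v → -1ℤ + y * v) (sym (evalMonic-replicate-0 e-1 y)))
    roots : ∀ x → x < p-1 → + p ∣ evalMonic Xᵉ-1 (+ suc x)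
    roots x x<p-1 = subst (+ p ∣_) (evalMonic-Xᵉ-1 (+ suc x)) (∣-difference xᵉ≡1)
      where
      xᵉ≡1 : (+ suc x) ^ e ≡ 1ℤ mod p
      xᵉ≡1 = decidable-stable ((+ suc x) ^ e ≡? 1ℤ mod p) (λ xᵉ≢1 → ∄x (x , x<p-1 , xᵉ≢1))
    p-1≤e : p-1 ≤ e
    p-1≤e = subst (p-1 ≤_) (cong suc (length-replicate e-1))
      (roots-bound p-prime p-1 (ℕ.n<1+n p-1) Xᵉ-1 roots)

  ∃-root-of-unity≢1-mod-prime-power : ∀ {p d} → Prime p → 1 < d → d ℕ.∣ p ∸ 1 → ∀ i →
    ∃ λ z → z ^ d ≡ 1ℤ mod p ℕ.^ suc i × ¬ (z ≡ 1ℤ mod p)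
  ∃-root-of-unity≢1-mod-prime-power {p} {d} p-prime 1<d d∣p-1 i
    with ∃-root-of-unity≢1 p-prime 1<d d∣p-1
  ... | y , yᵈ≡1 , y≢1 = y ^ (p ℕ.^ i) , zᵈ≡1 , z≢1
    where
    exponents-commute : (y ^ d) ^ (p ℕ.^ i) ≡ (y ^ (p ℕ.^ i)) ^ d
    exponents-commute = begin
      (y ^ d) ^ (p ℕ.^ i)   ≡⟨ ^-*-assoc y d (p ℕ.^ i) ⟩
      y ^ (d ℕ.* p ℕ.^ i)   ≡⟨ cong (y ^_) (ℕ.*-comm d (p ℕ.^ i)) ⟩
      y ^ (p ℕ.^ i ℕ.* d)   ≡⟨ sym (^-*-assoc y (p ℕ.^ i) d) ⟩
      (y ^ (p ℕ.^ i)) ^ d   ∎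
      where open ≡-Reasoning
    zᵈ≡1 : (y ^ (p ℕ.^ i)) ^ d ≡ 1ℤ mod p ℕ.^ suc i
    zᵈ≡1 = subst (λ v → v ≡ 1ℤ mod p ℕ.^ suc i) exponents-commute (^-lift-prime-power yᵈ≡1 i)
    z≢1 : ¬ (y ^ (p ℕ.^ i) ≡ 1ℤ mod p)
    z≢1 z≡1 = y≢1 (≡mod-trans (≡mod-sym (fermat-^ p-prime y i)) z≡1)

module Representatives where

  open import Defs using (absMod)
  open import Data.Nat.Base as ℕ using (ℕ; zero; suc; _∸_; _≤_; NonZero; >-nonZero)
  import Data.Nat.Properties as ℕ
  open import Data.Nat.Divisibility as ℕ using (divides)
  open import Data.Nat.DivMod using (_%_; m%n<n; [m+kn]%n≡m%n)
  open import Data.Nat.Coprimality using (Coprime)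
  open import Data.Integer.Base using (+_; _+_; _-_; _*_; _^_; ∣_∣; 0ℤ; 1ℤ)
  open import Data.Integer.Properties using ([+m]-[+n]≡m⊖n; ⊖-≥; ∣i-j∣≤∣i∣+∣j∣; pos-+; pos-*)
  open import Data.Integer.Divisibility.Signed
    using (_∣_; divides; ∣ᵤ⇒∣; ∣⇒∣ᵤ; ∣m⇒∣m*n; ∣m∣n⇒∣m-n; ∣-trans)
  open import Data.Integer.Tactic.RingSolver using (solve-∀)
  open import Data.Product.Base using (_,_)
  open import Data.Sum.Base using (inj₁; inj₂)
  open import Relation.Nullary.Negation using (¬_)
  open import Relation.Binary.PropositionalEquality
  open Congruence

  pos-^ : ∀ a n → + (a ℕ.^ n) ≡ (+ a) ^ n
  pos-^ a zero    = refl
  pos-^ a (suc n) = trans (pos-* a (a ℕ.^ n)) (cong (+ a *_) (pos-^ a n))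

  pos-∸ : ∀ {a c} → c ≤ a → + (a ∸ c) ≡ + a - + c
  pos-∸ {a} {c} c≤a = sym (trans ([+m]-[+n]≡m⊖n a c) (⊖-≥ c≤a))

  ≡mod⇒%≡-≤ : ∀ {q a c} .{{_ : NonZero q}} → c ≤ a → + a ≡ + c mod q → a % q ≡ c % q
  ≡mod⇒%≡-≤ {q} {a} {c} c≤a a≡c with subst (q ℕ.∣_) (cong ∣_∣ (sym (pos-∸ c≤a))) (∣⇒∣ᵤ (∣-difference a≡c))
  ... | divides k a-c≡kq = begin
    a % q                ≡⟨ cong (_% q) (sym (ℕ.m+[n∸m]≡n c≤a)) ⟩
    (c ℕ.+ (a ∸ c)) % q  ≡⟨ cong (λ x → (c ℕ.+ x) % q) a-c≡kq ⟩
    (c ℕ.+ k ℕ.* q) % q  ≡⟨ [m+kn]%n≡m%n c k q ⟩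
    c % q                ∎
    where open ≡-Reasoning

  ≡mod⇒%≡ : ∀ {q a c} .{{_ : NonZero q}} → + a ≡ + c mod q → a % q ≡ c % q
  ≡mod⇒%≡ {q} {a} {c} a≡c with ℕ.≤-total c a
  ... | inj₁ c≤a = ≡mod⇒%≡-≤ c≤a a≡c
  ... | inj₂ a≤c = sym (≡mod⇒%≡-≤ a≤c (≡mod-sym a≡c))

  ^≡1-mod⇒coprime : ∀ {b q n} .{{_ : NonZero n}} → (+ b) ^ n ≡ 1ℤ mod q → Coprime b q
  ^≡1-mod⇒coprime {b} {q} {suc n} bⁿ≡1 {c} (c∣b , c∣q) = ℕ.∣1⇒≡1 (∣⇒∣ᵤ c∣1)
    where
    cancel : ∀ x → x - (x - 1ℤ) ≡ 1ℤ
    cancel = solve-∀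
    c∣1 : + c ∣ 1ℤ
    c∣1 = subst (+ c ∣_) (cancel ((+ b) ^ suc n))
      (∣m∣n⇒∣m-n (∣m⇒∣m*n ((+ b) ^ n) (∣ᵤ⇒∣ {+ c} {+ b} c∣b))
                 (∣-trans (∣ᵤ⇒∣ {+ c} {+ q} c∣q) (∣-difference bⁿ≡1)))

  -- With s = a mod q, both s − c and (q − s) + c are multiples of r, and the first is nonzero.
  absMod-bound : ∀ {q r a c} .{{_ : NonZero q}} →
    r ℕ.∣ q → + a ≡ + c mod r → ¬ (+ a ≡ + c mod q) → r ≤ absMod q a ℕ.+ c
  absMod-bound {q} {r} {a} {c} r∣q a≡c a≢c =
    subst (r ≤_) (sym (ℕ.+-distribʳ-⊓ c s (q ∸ s))) (ℕ.⊓-glb r≤s+c r≤q-s+c)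
    where
    s = a % q
    s≡a : + s ≡ + a mod q
    s≡a = %ℕ-≡mod q (+ a)
    r∣s-c : + r ∣ + s - + c
    r∣s-c = ∣-difference (≡mod-trans (≡mod-divisor r∣q s≡a) a≡c)
    r≤s+c : r ≤ s ℕ.+ c
    r≤s+c = ℕ.≤-trans (∣⇒≤∣∣ r∣s-c s-c≢0) (∣i-j∣≤∣i∣+∣j∣ (+ s) (+ c))
      where
      s-c≢0 : + s - + c ≢ 0ℤ
      s-c≢0 s-c≡0 =
        a≢c (≡mod-trans (≡mod-sym s≡a) (mod-∣ (subst (+ q ∣_) (sym s-c≡0) (divides 0ℤ refl))))
    r≤q-s+c : r ≤ (q ∸ s) ℕ.+ c
    r≤q-s+c = ℕ.∣⇒≤ {{>-nonZero (ℕ.≤-trans (ℕ.m<n⇒0<n∸m (m%n<n a q)) (ℕ.m≤m+n (q ∸ s) c))}}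
      (∣⇒∣ᵤ (subst (+ r ∣_) (sym q-s+c≡q-[s-c]) (∣m∣n⇒∣m-n (∣ᵤ⇒∣ {+ r} {+ q} r∣q) r∣s-c)))
      where
      regroup : ∀ q s c → (q - s) + c ≡ q - (s - c)
      regroup = solve-∀
      q-s+c≡q-[s-c] : + ((q ∸ s) ℕ.+ c) ≡ + q - (+ s - + c)
      q-s+c≡q-[s-c] = begin
        + ((q ∸ s) ℕ.+ c)  ≡⟨ pos-+ (q ∸ s) c ⟩
        + (q ∸ s) + + c    ≡⟨ cong (_+ + c) (pos-∸ (ℕ.<⇒≤ (m%n<n a q))) ⟩
        (+ q - + s) + + c  ≡⟨ regroup (+ q) (+ s) (+ c) ⟩
        + q - (+ s - + c)  ∎
        where open ≡-Reasoning

module Construction where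

  open import Defs using (InP; absMod)
  open import Data.Nat.Base as ℕ using (ℕ; suc; _∸_; _<_; _≤_; NonZero)
  import Data.Nat.Properties as ℕ
  open import Data.Nat.Divisibility as ℕ using (_∤_)
  open import Data.Nat.DivMod using (_%_)
  open import Data.Nat.GCD using (gcd[m,n]∣m; gcd[m,n]∣n)
  open import Data.Nat.Coprimality using (Coprime)
  open import Data.Nat.Primality using (Prime)
  open import Data.Integer.Base using (ℤ; +_; _*_; _^_; 1ℤ)
  open import Data.Integer.Properties using (*-identityʳ; pos-*)
  open import Data.Integer.Divisibility.Signed using (∣⇒∣ᵤ)
  open import Data.Product.Base using (∃; _,_; _×_)
  open import Function.Base using (_∘_)
  open import Relation.Nullary.Negation using (¬_)
  open import Relation.Binary.PropositionalEquality
  open Congruence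
  open PrimeModulus using (*-cancelˡ-mod)
  open RootsOfUnity using (∃-root-of-unity≢1-mod-prime-power)
  open Representatives

  root-with-large-|nb| : ∀ {n p m r b} {z : ℤ} .{{_ : NonZero n}} .{{_ : NonZero (r ℕ.* p ℕ.^ suc m)}} →
    Prime p → p ∤ n → Coprime r (p ℕ.^ suc m) → z ^ n ≡ 1ℤ mod p ℕ.^ suc m → ¬ (z ≡ 1ℤ mod p) →
    + b ≡ 1ℤ mod r → + b ≡ z mod p ℕ.^ suc m →
    let q = r ℕ.* p ℕ.^ suc m in
    Coprime b q × (b ℕ.^ n) % q ≡ 1 % q × r ≤ absMod q (n ℕ.* b) ℕ.+ n
  root-with-large-|nb| {n} {p} {m} {r} {b} {z} p-prime p∤n r⊥P zⁿ≡1 z≢1 b≡1 b≡z =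
    ^≡1-mod⇒coprime bⁿ≡1 ,
    ≡mod⇒%≡ (≡mod-trans {b = (+ b) ^ n} (≡mod-reflexive (pos-^ b n)) bⁿ≡1) ,
    absMod-bound (ℕ.m∣m*n P) (≡mod-trans {b = + n * + b} (≡mod-reflexive (pos-* n b)) nb≡n)
      (nb≢n ∘ ≡mod-trans {b = + (n ℕ.* b)} (≡mod-reflexive (sym (pos-* n b))))
    where
    P = p ℕ.^ suc m
    bⁿ≡1 : (+ b) ^ n ≡ 1ℤ mod r ℕ.* P
    bⁿ≡1 = ≡mod-coprime-* r⊥P (≡1-mod⇒^≡1-mod n b≡1)
             (≡mod-trans {b = z ^ n} (^-cong-mod n b≡z) zⁿ≡1)
    nb≡n : + n * + b ≡ + n mod r
    nb≡n = ≡mod-trans {b = + n * 1ℤ} (*-cong-mod (≡mod-refl {a = + n}) b≡1)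
             (≡mod-reflexive (*-identityʳ (+ n)))
    nb≢n : ¬ (+ n * + b ≡ + n mod r ℕ.* P)
    nb≢n nb≡n-mod-rP = z≢1 (≡mod-trans {b = + b} (≡mod-sym (≡mod-divisor p∣P b≡z)) b≡1-mod-p)
      where
      p∣P : p ℕ.∣ P
      p∣P = ℕ.m∣m*n (p ℕ.^ m)
      b≡1-mod-p : + b ≡ 1ℤ mod p
      b≡1-mod-p = *-cancelˡ-mod p-prime {+ n} {+ b} {1ℤ} (p∤n ∘ ∣⇒∣ᵤ)
        (≡mod-trans {b = + n} (≡mod-divisor (ℕ.∣-trans p∣P (ℕ.n∣m*n r)) nb≡n-mod-rP)
                    (≡mod-reflexive (sym (*-identityʳ (+ n)))))

  ∃-root-with-large-|nb| : ∀ {n p m q r} .{{_ : NonZero n}} .{{_ : NonZero q}} →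
    InP n p → q ≡ r ℕ.* p ℕ.^ suc m → Coprime r (p ℕ.^ suc m) →
    ∃ λ b → b < q × Coprime b q × (b ℕ.^ n) % q ≡ 1 % q × r ≤ absMod q (n ℕ.* b) ℕ.+ n
  ∃-root-with-large-|nb| {n} {p} {m} {q} {r} (p-prime , 1<d , p∤n) refl r⊥P =
    let (z , zᵈ≡1 , z≢1) = ∃-root-of-unity≢1-mod-prime-power p-prime 1<d (gcd[m,n]∣m (p ∸ 1) n) m
        (b , b<q , b≡1 , b≡z) = ∃-representative (ℕ.m∣m*n (p ℕ.^ suc m)) (ℕ.n∣m*n r) r⊥P 1ℤ z
    in  b , b<q , root-with-large-|nb| {n} {p} {m} {r} {b} {z} p-prime p∤n r⊥P
                    (^≡1-mod-∣ zᵈ≡1 (gcd[m,n]∣n (p ∸ 1) n)) z≢1 b≡1 b≡z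

open import Defs
open import Data.Nat using (ℕ; _∸_; _+_; _*_; _^_; _<_; NonZero)
open import Data.Nat.DivMod using (_%_)
open import Data.Nat.Coprimality using (Coprime)
open import Data.Product using (Σ; _×_)
open import Relation.Binary.PropositionalEquality using (_≡_)

open import Data.Nat using (zero; suc)
open import Data.Nat.Properties
  using (*-comm; *-assoc; *-monoʳ-<; *-cancelʳ-<; <-≤-trans; ^-monoˡ-≤; m^n≢0)
open import Data.Nat.Divisibility using (_∤_; divides; ∣-trans; ∣1⇒≡1)
open import Data.Nat.Coprimality using (coprime-divisor) renaming (sym to coprime-sym)
open import Data.Nat.Primality using (Prime; prime⇒irreducible)
open import Data.Nat.Tactic.RingSolver using (solve-∀)
open import Data.Product using (_,_; proj₁)
open import Data.Sum using (inj₁; inj₂)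
open import Relation.Nullary.Negation using (contradiction)
open import Relation.Binary.PropositionalEquality using (refl; trans; cong; subst)
open Construction using (∃-root-with-large-|nb|)

prime∤⇒coprime : ∀ {p n} → Prime p → p ∤ n → Coprime p n
prime∤⇒coprime p-prime p∤n (d∣p , d∣n) with prime⇒irreducible p-prime d∣p
... | inj₁ d≡1  = d≡1
... | inj₂ refl = contradiction d∣n p∤n

coprime-* : ∀ {m n o} → Coprime m o → Coprime n o → Coprime (m * n) o
coprime-* m⊥o n⊥o {d} (d∣mn , d∣o) = n⊥o (coprime-divisor d⊥m d∣mn , d∣o)
  where
  d⊥m : Coprime d _
  d⊥m (e∣d , e∣m) = m⊥o (e∣m , ∣-trans e∣d d∣o)

coprime-^ : ∀ {m n} k → Coprime m n → Coprime (m ^ k) n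
coprime-^ zero    _   (d∣1 , _) = ∣1⇒≡1 d∣1
coprime-^ (suc k) m⊥n = coprime-* m⊥n (coprime-^ k m⊥n)

cofactor-coprime : ∀ {p m q r} → Prime p → q ≡ r * p ^ m → p ^ suc m ∤ q → Coprime r (p ^ m)
cofactor-coprime {p} {m} {q} {r} p-prime q≡rpᵐ pᵐ⁺¹∤q =
  coprime-sym (coprime-^ m (prime∤⇒coprime p-prime p∤r))
  where
  p∤r : p ∤ r
  p∤r (divides s r≡sp) =
    pᵐ⁺¹∤q (divides s (trans q≡rpᵐ (trans (cong (_* p ^ m) r≡sp) (*-assoc s p (p ^ m)))))

^-distribʳ-* : ∀ m n k → (m * n) ^ k ≡ m ^ k * n ^ k
^-distribʳ-* m n zero    = refl
^-distribʳ-* m n (suc k) = trans (cong (m * n *_) (^-distribʳ-* m n k)) (interchange m n (m ^ k) (n ^ k))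
  where
  interchange : ∀ a b c d → a * b * (c * d) ≡ a * c * (b * d)
  interchange = solve-∀

-- qᵏ Pᵏ⁺¹ < qᵏ q = (r P)ᵏ⁺¹ = rᵏ⁺¹ Pᵏ⁺¹.
cofactor-power-bound : ∀ {q r P} .{{_ : NonZero q}} k → q ≡ r * P → P ^ suc k < q → q ^ k < r ^ suc k
cofactor-power-bound {q} {r} {P} k q≡rP Pᵏ⁺¹<q =
  *-cancelʳ-< (P ^ suc k) (q ^ k) (r ^ suc k)
    (subst (q ^ k * P ^ suc k <_) qᵏq≡rᵏ⁺¹Pᵏ⁺¹ (*-monoʳ-< (q ^ k) Pᵏ⁺¹<q))
  where
  instance _ = m^n≢0 q k
  qᵏq≡rᵏ⁺¹Pᵏ⁺¹ : q ^ k * q ≡ r ^ suc k * P ^ suc k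
  qᵏq≡rᵏ⁺¹Pᵏ⁺¹ = trans (*-comm (q ^ k) q) (trans (cong (_^ suc k) q≡rP) (^-distribʳ-* r P (suc k)))

proposition3p1 : (n k q : ℕ) .{{_ : NonZero n}} .{{_ : NonZero k}} .{{_ : NonZero q}} →
    SmallPFactor n k q →
    Σ ℕ λ b → b < q × Coprime b q × (b ^ n) % q ≡ 1 % q ×
    q ^ (k ∸ 1) < (absMod q (n * b) + n) ^ k
proposition3p1 n k q (p , zero , _ , () , _)
proposition3p1 n (suc k) q (p , suc m , p∈P , _ , divides r q≡rP , Pp∤q , Pᵏ<q)
  with ∃-root-with-large-|nb| {m = m} {r = r} p∈P q≡rP (cofactor-coprime {m = suc m} (proj₁ p∈P) q≡rP Pp∤q)
... | b , b<q , b⊥q , bⁿ≡1 , r≤|nb|+n =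
  b , b<q , b⊥q , bⁿ≡1 ,
  <-≤-trans (cofactor-power-bound {r = r} {P = p ^ suc m} k q≡rP Pᵏ<q) (^-monoˡ-≤ (suc k) r≤|nb|+n)
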